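{- Let $G=(V,E)$ be a graph and $S\subseteq V$. Suppose that the induced subgraph $G[S]$ has a $C_4$-isolating set $D$ such that for every connected component $H$ of $G[S]-N_{G[S]}[D]$, the number of edges of $G$ with one end in $V(H)$ and the other end in $V\setminus S$ is at most $1$. Then $\iota(G,C_4) \leq |D| + \iota(G-S,C_4)$.
   Context: All graphs are finite and simple. $C_4$ is the cycle of length 4. For a graph $F$ and $D\subseteq V(F)$, $N_F[D]$ is the closed neighbourhood of $D$ in $F$ (vertices of $D$ together with their neighbours in $F$), and $F-X$ denotes the subgraph of $F$ induced by $V(F)\setminus X$. A set $D\subseteq V(F)$ is a $C_4$-isolating set of $F$ if $F-N_F[D]$ contains no subgraph isomorphic to $C_4$; $\iota(F,C_4)$ is the minimum cardinality of a $C_4$-isolating set of $F$ (equal to $0$ for the empty graph). $G[S]$ is the subgraph of $G$ induced by $S$, and $G-S$ is the subgraph induced by $V\setminus S$. -}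

module Defs where

open import Data.Nat using (ℕ)
open import Data.Bool using (Bool; true; false)
open import Data.Fin using (Fin)
open import Data.Fin.Subset using (Subset; _∈_; _∉_; _⊆_; ∣_∣)
open import Data.Product using (Σ; ∃; _×_)
open import Data.Sum using (_⊎_)
open import Relation.Nullary using (¬_)
open import Relation.Binary.PropositionalEquality using (_≡_; _≢_)

record Graph (n : ℕ) : Set where
  field
    adj    : Fin n → Fin n → Bool
    sym    : ∀ i j → adj i j ≡ adj j i
    irrefl : ∀ i → adj i i ≡ false

open Graph public

Edge : ∀ {n} → Graph n → Fin n → Fin n → Set
Edge G i j = adj G i j ≡ true

InClosedNbhd : ∀ {n} → Graph n → (W D : Subset n) → Fin n → Set
InClosedNbhd G W D v = v ∈ W × (v ∈ D ⊎ Σ (Fin n) λ d → d ∈ D × Edge G v d)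
  where n = _

Remaining : ∀ {n} → Graph n → (W D : Subset n) → Fin n → Set
Remaining G W D v = v ∈ W × ¬ InClosedNbhd G W D v

HasC4 : ∀ {n} → Graph n → (Fin n → Set) → Set
HasC4 {n} G P = Σ (Fin n) λ a → Σ (Fin n) λ b → Σ (Fin n) λ c → Σ (Fin n) λ d →
  (P a × P b × P c × P d) ×
  (a ≢ b × a ≢ c × a ≢ d × b ≢ c × b ≢ d × c ≢ d) ×
  (Edge G a b × Edge G b c × Edge G c d × Edge G d a)

IsolatingIn : ∀ {n} → Graph n → (W D : Subset n) → Set
IsolatingIn G W D = D ⊆ W × ¬ HasC4 G (Remaining G W D)

IsIota : ∀ {n} → Graph n → Subset n → ℕ → Set
IsIota {n} G W k =
  (Σ (Subset n) λ D → IsolatingIn G W D × ∣ D ∣ ≡ k) ×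
  (∀ D → IsolatingIn G W D → k Data.Nat.≤ ∣ D ∣)

-- Reach R u v : v is reachable from u by a path all of whose vertices lie in R
-- (so for u with R u, {v | Reach R u v} is the connected component of u in G[R]).
data Reach {n} (G : Graph n) (R : Fin n → Set) : Fin n → Fin n → Set where
  here : ∀ {u} → R u → Reach G R u u
  step : ∀ {u v w} → Reach G R u v → Edge G v w → R w → Reach G R u w

{-# OPTIONS --safe #-}
module Submission where

-- Take D ∪ D′ with D′ a minimum C4-isolating set of G − S. A C4 surviving in
-- G − N[D ∪ D′] cannot lie inside S (D isolates G[S]) nor inside V ∖ S (D′ isolates
-- G − S), so it crosses the cut and leaves S along an edge a b with a ∈ S. Following
-- the cycle backwards from a inside S until it leaves S again exhibits a second edge
-- from the same component of G[S] − N[D] to V ∖ S; the single-exit hypothesis forces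
-- the two edges to coincide, contradicting the distinctness of the cycle's vertices.

open import Defs
open import Data.Nat using (_≤_; _+_; s≤s; z≤n)
open import Data.Nat.Properties using (≤-trans; ≤-reflexive; +-suc; +-monoʳ-≤; n≤1+n; module ≤-Reasoning)
open import Data.Fin using (Fin)
open import Data.Fin.Subset using (Subset; inside; outside; _∈_; _∉_; _⊆_; ∣_∣; ⊤; ∁; _∪_)
open import Data.Fin.Subset.Properties using (_∈?_; ∈⊤; x∉p⇒x∈∁p; p⊆p∪q; q⊆p∪q)
open import Data.Vec using ([]; _∷_)
open import Data.Empty using (⊥)
open import Data.Product using (_×_; _,_; proj₁; proj₂)
open import Data.Sum using (inj₁; inj₂)
open import Relation.Nullary using (¬_; yes; no)
open import Relation.Binary.PropositionalEquality using (_≡_; _≢_; trans; cong; ≢-sym) renaming (sym to ≡-sym)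

∣p∪q∣≤∣p∣+∣q∣ : ∀ {n} (p q : Subset n) → ∣ p ∪ q ∣ ≤ ∣ p ∣ + ∣ q ∣
∣p∪q∣≤∣p∣+∣q∣ []            []            = z≤n
∣p∪q∣≤∣p∣+∣q∣ (inside  ∷ p) (inside  ∷ q) = s≤s (≤-trans (∣p∪q∣≤∣p∣+∣q∣ p q) (+-monoʳ-≤ ∣ p ∣ (n≤1+n ∣ q ∣)))
∣p∪q∣≤∣p∣+∣q∣ (inside  ∷ p) (outside ∷ q) = s≤s (∣p∪q∣≤∣p∣+∣q∣ p q)
∣p∪q∣≤∣p∣+∣q∣ (outside ∷ p) (inside  ∷ q) = ≤-trans (s≤s (∣p∪q∣≤∣p∣+∣q∣ p q)) (≤-reflexive (≡-sym (+-suc ∣ p ∣ ∣ q ∣)))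
∣p∪q∣≤∣p∣+∣q∣ (outside ∷ p) (outside ∷ q) = ∣p∪q∣≤∣p∣+∣q∣ p q

module _ {n} (G : Graph n) where

  Edge-sym : ∀ {u v} → Edge G u v → Edge G v u
  Edge-sym {u} {v} e = trans (Graph.sym G v u) e

  remaining-restrict : ∀ {W D X v} → D ⊆ X → v ∈ W → Remaining G ⊤ X v → Remaining G W D v
  remaining-restrict D⊆X v∈W (_ , v∉N[X]) = v∈W , λ
    { (_ , inj₁ v∈D)             → v∉N[X] (∈⊤ , inj₁ (D⊆X v∈D))
    ; (_ , inj₂ (d , d∈D , vd)) → v∉N[X] (∈⊤ , inj₂ (d , D⊆X d∈D , vd)) }

  SingleExit : Subset n → (Fin n → Set) → Set
  SingleExit S R = ∀ u x y x′ y′ → Reach G R u x → Reach G R u x′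
    → y ∉ S → y′ ∉ S → Edge G x y → Edge G x′ y′ → x ≡ x′ × y ≡ y′

  Cycle4 : (a b c d : Fin n) → Set
  Cycle4 a b c d =
    (a ≢ b × a ≢ c × a ≢ d × b ≢ c × b ≢ d × c ≢ d) ×
    (Edge G a b × Edge G b c × Edge G c d × Edge G d a)

  C4In : (Fin n → Set) → (a b c d : Fin n) → Set
  C4In P a b c d = (P a × P b × P c × P d) × Cycle4 a b c d

  C4In-rotate : ∀ {P a b c d} → C4In P a b c d → C4In P b c d a
  C4In-rotate ((pa , pb , pc , pd) , (ab , ac , ad , bc , bd , cd) , (eab , ebc , ecd , eda)) =
    (pb , pc , pd , pa) , (bc , bd , ≢-sym ab , cd , ≢-sym ac , ≢-sym ad) , (ebc , ecd , eda , eab)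

  C4In-crossing-impossible : ∀ {S R P a b c d} → SingleExit S R → (∀ {v} → P v → v ∈ S → R v)
    → C4In P a b c d → a ∈ S → b ∉ S → ⊥
  C4In-crossing-impossible {S} {c = c} {d} exit inR
    ((pa , pb , pc , pd) , (ab , ac , ad , bc , bd , cd) , (eab , ebc , ecd , eda)) a∈S b∉S
    with inR pa a∈S | d ∈? S | c ∈? S
  ... | ra | no d∉S | _ =
    bd (proj₂ (exit _ _ _ _ _ (here ra) (here ra) b∉S d∉S eab (Edge-sym eda)))
  ... | ra | yes d∈S | no c∉S =
    ad (proj₁ (exit _ _ _ _ _ (here ra) a→d b∉S c∉S eab (Edge-sym ecd)))
    where a→d = step (here ra) (Edge-sym eda) (inR pd d∈S)
  ... | ra | yes d∈S | yes c∈S =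
    ac (proj₁ (exit _ _ _ _ _ (here ra) a→c b∉S b∉S eab (Edge-sym ebc)))
    where a→c = step (step (here ra) (Edge-sym eda) (inR pd d∈S)) (Edge-sym ecd) (inR pc c∈S)

  no-C4-across-single-exit : ∀ {S R R′ P} → SingleExit S R → ¬ HasC4 G R → ¬ HasC4 G R′
    → (∀ {v} → P v → v ∈ S → R v) → (∀ {v} → P v → v ∉ S → R′ v) → ¬ HasC4 G P
  no-C4-across-single-exit {S} exit noR noR′ inR inR′ (a , b , c , d , c4@((pa , pb , pc , pd) , cyc))
    with a ∈? S | b ∈? S | c ∈? S | d ∈? S
  -- Unless the cycle lies on one side of S, some consecutive pair of it leaves S.
  ... | yes a∈S | no b∉S | _ | _ = C4In-crossing-impossible exit inR
    c4 a∈S b∉S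
  ... | _ | yes b∈S | no c∉S | _ = C4In-crossing-impossible exit inR
    (C4In-rotate c4) b∈S c∉S
  ... | _ | _ | yes c∈S | no d∉S = C4In-crossing-impossible exit inR
    (C4In-rotate (C4In-rotate c4)) c∈S d∉S
  ... | no a∉S | _ | _ | yes d∈S = C4In-crossing-impossible exit inR
    (C4In-rotate (C4In-rotate (C4In-rotate c4))) d∈S a∉S
  ... | yes a∈S | yes b∈S | yes c∈S | yes d∈S =
    noR (a , b , c , d , (inR pa a∈S , inR pb b∈S , inR pc c∈S , inR pd d∈S) , cyc)
  ... | no a∉S | no b∉S | no c∉S | no d∉S =
    noR′ (a , b , c , d , (inR′ pa a∉S , inR′ pb b∉S , inR′ pc c∉S , inR′ pd d∉S) , cyc)

lemma2p1 : ∀ {n} (G : Graph n) (S D : Subset n)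
    → IsolatingIn G S D
    → (∀ u x y x′ y′
         → Reach G (Remaining G S D) u x → Reach G (Remaining G S D) u x′
         → y ∉ S → y′ ∉ S → Edge G x y → Edge G x′ y′
         → x ≡ x′ × y ≡ y′)
    → ∀ k₁ k₂ → IsIota G ⊤ k₁ → IsIota G (∁ S) k₂
    → k₁ ≤ ∣ D ∣ + k₂
lemma2p1 G S D (_ , noC4inS) exit k₁ k₂ (_ , ι-minimal) ((D′ , (_ , noC4outS) , ∣D′∣≡k₂) , _) =
  begin
    k₁              ≤⟨ ι-minimal (D ∪ D′) ((λ _ → ∈⊤) , isolating) ⟩
    ∣ D ∪ D′ ∣      ≤⟨ ∣p∪q∣≤∣p∣+∣q∣ D D′ ⟩
    ∣ D ∣ + ∣ D′ ∣  ≡⟨ cong (∣ D ∣ +_) ∣D′∣≡k₂ ⟩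
    ∣ D ∣ + k₂      ∎
  where
  open ≤-Reasoning
  isolating : ¬ HasC4 G (Remaining G ⊤ (D ∪ D′))
  isolating = no-C4-across-single-exit G exit noC4inS noC4outS
    (λ r v∈S → remaining-restrict G (p⊆p∪q D′) v∈S r)
    (λ r v∉S → remaining-restrict G (q⊆p∪q D D′) (x∉p⇒x∈∁p v∉S) r)
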